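{- Let $\delta\in\{\mathsf{none},\mathsf{down},\mathsf{up},\mathsf{updown}\}^n$. The polytope $\mathcal{C}_\delta$ (the convex hull of the cubic vectors of all $\delta$-permutrees) is normally equivalent to the $(n-1)$-dimensional cube, i.e. it has the same normal fan as the cube.
   Context: A permutree on $n$ vertices is a directed (unrooted, planar) tree $T$ with vertex set $\{v_1,\dots,v_n\}$, edges oriented from child to parent, such that each vertex $v_i$ has exactly one or two parents and exactly one or two children, and: if $v_i$ has two parents then every vertex $v_j$ in its left ancestor subtree has $j<i$ and every $v_k$ in its right ancestor subtree has $k>i$; if $v_i$ has two children then every $v_j$ in its left descendant subtree $LD_i$ has $j<i$ and every $v_k$ in its right descendant subtree $RD_i$ has $k>i$ (ancestor/descendant subtrees are the components of $T\setminus v_i$ containing the respective parents/children; if $v_i$ has one child, $D_i$ denotes its unique descendant subtree). The decoration $\delta(T)_i$ is $\mathsf{none}$, $\mathsf{down}$, $\mathsf{up}$, $\mathsf{updown}$ according as $v_i$ has (one parent, one child), (one parent, two children), (two parents, one child), (two parents, two children); $\mathcal{PT}_n(\delta)$ is the set of permutrees with decoration $\delta$ (convention $\delta_1=\delta_n=\mathsf{none}$). The cubic set of $T$ is $C(T)=\{(i,j): i<j,\ v_j\in D_i\text{ if }\delta_i\in\{\mathsf{none},\mathsf{up}\};\ v_j\in RD_i\text{ if }\delta_i\in\{\mathsf{down},\mathsf{updown}\}\}$, with components $C(T)_i=\{j:(i,j)\in C(T)\}$, and the cubic vector is $\vec{c}(T)=(c_1,\dots,c_{n-1})\in\mathbb{R}^{n-1}$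 with $c_i=|C(T)_i|$. $\mathcal{C}_\delta$ denotes the convex hull of $\{\vec{c}(T):T\in\mathcal{PT}_n(\delta)\}$.
   Formalization: The directions in the normal fans of $\mathcal{C}_\delta$ and the cube range over ℚ^(n-1) rather than over $\mathbb{R}^{n-1}$. -}

module Defs where

open import Data.Nat as ℕ using (ℕ; zero; suc)
open import Data.Bool using (Bool; true; false; _∧_; _∨_; not)
open import Data.Fin as Fin using (Fin; zero; suc; inject₁; fromℕ; _<_)
open import Data.Fin.Subset using (Subset; ∣_∣)
open import Data.Vec using (tabulate)
open import Data.Integer using (+_)
open import Data.Rational as ℚ using (ℚ; 0ℚ; _/_)
open import Data.Product using (Σ; _×_; _,_)
open import Data.Sum using (_⊎_)
open import Relation.Nullary using (¬_; Dec; yes; no)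
open import Relation.Nullary.Decidable using (⌊_⌋)
open import Relation.Binary.PropositionalEquality using (_≡_)

data Decoration : Set where
  none down up updown : Decoration

-- number of parent slots / child slots (parents and children include
-- leaves, i.e. dangling half-edges, which are not vertices)
parentSlots : Decoration → ℕ
parentSlots none   = 1
parentSlots down   = 1
parentSlots up     = 2
parentSlots updown = 2

childSlots : Decoration → ℕ
childSlots none   = 1
childSlots down   = 2
childSlots up     = 1
childSlots updown = 2

anyFin : ∀ {n} → (Fin n → Bool) → Bool
anyFin {zero}  f = false
anyFin {suc n} f = f zero ∨ anyFin (λ i → f (suc i))

countFin : ∀ {n} → (Fin n → Bool) → ℕ
countFin f = ∣ tabulate f ∣

sumFin : ∀ {n} → (Fin n → ℚ) → ℚ
sumFin {zero}  f = 0ℚ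
sumFin {suc n} f = f zero ℚ.+ sumFin (λ i → f (suc i))

eqB : ∀ {n} → Fin n → Fin n → Bool
eqB i j = ⌊ i Fin.≟ j ⌋

ltB : ∀ {n} → Fin n → Fin n → Bool
ltB i j = ⌊ i Fin.<? j ⌋

-- Directed graphs on the vertex set Fin n (vertex v_{k+1} is the
-- element k of Fin n, so the order of labels is the order on Fin n).
-- E c p = true  means there is an edge c → p  (c is a child of p).

Graph : ℕ → Set
Graph n = Fin n → Fin n → Bool

adj : ∀ {n} → Graph n → Fin n → Fin n → Bool
adj E x y = E x y ∨ E y x

-- reachW E a k x y : y is reachable from x by an undirected walk of
-- length ≤ k in the underlying graph of E with vertex a deleted
-- (used with x ≠ a).
reachW : ∀ {n} → Graph n → Fin n → ℕ → Fin n → Fin n → Bool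
reachW E a zero    x y = eqB x y
reachW E a (suc k) x y =
  reachW E a k x y ∨ anyFin (λ z → reachW E a k x z ∧ adj E z y ∧ not (eqB y a))

reachAll : ∀ {n} → Graph n → ℕ → Fin n → Fin n → Bool
reachAll E zero    x y = eqB x y
reachAll E (suc k) x y =
  reachAll E k x y ∨ anyFin (λ z → reachAll E k x z ∧ adj E z y)

-- InComp E i a j : for a neighbour a of i, the vertex j lies in the
-- connected component of T ∖ v_i containing a.
InComp : ∀ {n} → Graph n → Fin n → Fin n → Fin n → Set
InComp {n} E i a j = reachW E i n a j ≡ true

parentCount : ∀ {n} → Graph n → Fin n → ℕ
parentCount E i = countFin (λ p → E i p)

childCount : ∀ {n} → Graph n → Fin n → ℕ
childCount E i = countFin (λ c → E c i)

edgeCount : ∀ {n} → Graph n → ℕ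
edgeCount {n} E = sumN (λ x → countFin (λ y → E x y))
  where
  sumN : ∀ {m} → (Fin m → ℕ) → ℕ
  sumN {zero}  f = 0
  sumN {suc m} f = f zero ℕ.+ sumN (λ i → f (suc i))

-- The neighbours N (parents, resp. children) of i split into (at most)
-- a "left" neighbour whose component of T ∖ v_i has all labels < i and
-- a "right" neighbour whose component has all labels > i.
LeftRightSplit : ∀ {n} → Graph n → Fin n → (Fin n → Bool) → Set
LeftRightSplit E i N =
  (∀ a j k → N a ≡ true → InComp E i a j → InComp E i a k →
     ¬ (j < i × i < k))
  × (∀ a b j k → N a ≡ true → N b ≡ true → InComp E i a j → InComp E i b k →
     ((j < i × k < i) ⊎ (i < j × i < k)) → a ≡ b)

record Permutree (n : ℕ) (δ : Fin n → Decoration) : Set where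
  field
    edge        : Graph n
    irreflexive : ∀ x → edge x x ≡ false
    asymmetric  : ∀ x y → edge x y ≡ true → edge y x ≡ false
    connected   : ∀ x y → reachAll edge n x y ≡ true
    edges       : suc (edgeCount edge) ≡ n
    -- δ(T) = δ : the number of parents / children (vertices among them,
    -- the remaining ones being leaves) fits the slots of δ_i
    parentsOK   : ∀ i → parentCount edge i ℕ.≤ parentSlots (δ i)
    childrenOK  : ∀ i → childCount edge i ℕ.≤ childSlots (δ i)
    upOK        : ∀ i → parentSlots (δ i) ≡ 2 →
                    LeftRightSplit edge i (λ p → edge i p)
    downOK      : ∀ i → childSlots (δ i) ≡ 2 →
                    LeftRightSplit edge i (λ c → edge c i)

open Permutree public

inDescB : ∀ {n} → Graph n → Fin n → Fin n → Bool
inDescB {n} E i j = anyFin (λ c → E c i ∧ reachW E i n c j)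

-- C(T)_i = { j > i : j ∈ D_i }         if δ_i ∈ {none, up}
--        = { j > i : j ∈ RD_i }        if δ_i ∈ {down, updown}
-- In both cases this is { j > i : j in a descendant subtree of i }:
-- for one child D_i is the unique descendant subtree; for two children
-- the labels > i in descendant subtrees are exactly those of RD_i
-- (LD_i only has labels < i).
cubicSet : ∀ {n δ} → Permutree n δ → Fin n → Subset n
cubicSet T i = tabulate (λ j → ltB i j ∧ inDescB (edge T) i j)

cubicVector : ∀ {m δ} → Permutree (suc m) δ → Fin m → ℕ
cubicVector T i = ∣ cubicSet T (inject₁ i) ∣

Point : ℕ → Set
Point m = Fin m → ℕ

PointSet : ℕ → Set₁
PointSet m = Point m → Set

toℚ : ℕ → ℚ
toℚ k = + k / 1

dot : ∀ {m} → (Fin m → ℚ) → Point m → ℚ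
dot w x = sumFin (λ i → w i ℚ.* toℚ (x i))

InFace : ∀ {m} → PointSet m → (Fin m → ℚ) → Point m → Set
InFace S w x = S x × (∀ y → S y → dot w y ℚ.≤ dot w x)

-- w and w' select the same face of conv(S) (faces are determined by the
-- points of S they contain), i.e. w and w' lie in the relative interior
-- of the same cone of the normal fan of conv(S)
SameFace : ∀ {m} → PointSet m → (Fin m → ℚ) → (Fin m → ℚ) → Set
SameFace S w w' = ∀ x → (InFace S w x → InFace S w' x) × (InFace S w' x → InFace S w x)

NormallyEquivalent : ∀ {m} → PointSet m → PointSet m → Set
NormallyEquivalent S S' =
  ∀ w w' → (SameFace S w w' → SameFace S' w w') × (SameFace S' w w' → SameFace S w w')

cubeVertices : ∀ {m} → PointSet m
cubeVertices x = ∀ i → (x i ≡ 0) ⊎ (x i ≡ 1)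

-- cubic vectors of all δ-permutrees; C_δ is their convex hull
cubicVectors : ∀ {m} → (δ : Fin (suc m) → Decoration) → PointSet m
cubicVectors {m} δ x = Σ (Permutree (suc m) δ) (λ T → ∀ i → cubicVector T i ≡ x i)

-- Every cubic vector lies in the box ∏ᵢ [0, n − i], since cᵢ counts labels j > i, and every
-- vertex of this box is the cubic vector of a δ-permutree: given a sign pattern ε, hang each
-- vertex, from the top label down, on the first later vertex that still has a free slot of the
-- required kind, as its parent if εᵢ holds and as its child otherwise.  Then either all later
-- vertices descend from vᵢ or none does.  So C_δ is a box with positive side lengths, and for
-- every such box the face maximising a direction w is cut out by the signs of the coordinates of
-- w alone; hence it has the normal fan of the cube.

module Submission where

open import Defs
open import Data.Bool as Bool using (Bool; true; false; _∧_; _∨_; not; if_then_else_)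
open import Data.Bool.Properties
  using (∨-zeroʳ; ∨-comm; ∧-zeroʳ; ∧-identityʳ; not-¬; ¬-not; not-involutive)
open import Data.Empty using (⊥; ⊥-elim)
open import Data.Fin as Fin using (Fin; zero; suc; toℕ; fromℕ; inject₁)
import Data.Fin.Properties as Fin
open import Data.Fin.Induction using (>-wellFounded)
open import Data.Fin.Subset using (∣_∣)
open import Data.Fin.Subset.Properties using (p⊆q⇒∣p∣≤∣q∣)
import Data.Integer as ℤ
import Data.Integer.Properties as ℤ
open import Data.Nat as ℕ using (ℕ; zero; suc; _+_; _∸_; z≤n; s≤s)
open import Data.Nat.Divisibility using (∣1⇒≡1)
import Data.Nat.Properties as ℕ
open import Data.Product using (∃; _×_; _,_; proj₁; proj₂; swap)
open import Data.Rational as ℚ using (ℚ; 0ℚ; mkℚ; *≤*; *<*)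
import Data.Rational.Properties as ℚ
open import Data.Sum as Sum using (_⊎_; inj₁; inj₂; [_,_]′)
open import Data.Unit using (⊤)
open import Data.Vec using (tabulate)
open import Data.Vec.Properties using (tabulate-cong; lookup∘tabulate; []=⇒lookup; lookup⇒[]=)
open import Function using (_∘_)
open import Induction.WellFounded using (Acc; acc)
open import Relation.Binary.Definitions using (tri<; tri≈; tri>)
open import Relation.Binary.PropositionalEquality
open import Relation.Nullary using (Dec; yes; no; ¬_)
open import Relation.Nullary.Decidable using (isYes; isYes≗does; dec-true; dec-false)

false≢true : false ≢ true
false≢true ()

∨-true⁻ : ∀ {a b} → a ∨ b ≡ true → a ≡ true ⊎ b ≡ true
∨-true⁻ {true}  _ = inj₁ refl
∨-true⁻ {false} q = inj₂ q

∧-true⁻ : ∀ {a b} → a ∧ b ≡ true → a ≡ true × b ≡ true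
∧-true⁻ {true} q = refl , q

∨-trueˡ : ∀ {a} b → a ≡ true → a ∨ b ≡ true
∨-trueˡ _ refl = refl

∨-trueʳ : ∀ a {b} → b ≡ true → a ∨ b ≡ true
∨-trueʳ a refl = ∨-zeroʳ a

∧-true⁺ : ∀ {a b} → a ≡ true → b ≡ true → a ∧ b ≡ true
∧-true⁺ refl refl = refl

witness : ∀ {A : Set} (a? : Dec A) → isYes a? ≡ true → A
witness (yes a) _ = a

isYes-true : ∀ {A : Set} (a? : Dec A) → A → isYes a? ≡ true
isYes-true a? a = trans (isYes≗does a?) (dec-true a? a)

eqB⇒≡ : ∀ {n} {x y : Fin n} → eqB x y ≡ true → x ≡ y
eqB⇒≡ {x = x} {y} = witness (x Fin.≟ y)

≡⇒eqB : ∀ {n} {x y : Fin n} → x ≡ y → eqB x y ≡ true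
≡⇒eqB {x = x} {y} = isYes-true (x Fin.≟ y)

≢⇒eqB : ∀ {n} {x y : Fin n} → x ≢ y → eqB x y ≡ false
≢⇒eqB {x = x} {y} x≢y = trans (isYes≗does _) (dec-false (x Fin.≟ y) x≢y)

not-eqB⇒≢ : ∀ {n} {x y : Fin n} → not (eqB x y) ≡ true → x ≢ y
not-eqB⇒≢ q refl = false≢true (trans (sym (cong not (≡⇒eqB refl))) q)

ltB⇒< : ∀ {n} {x y : Fin n} → ltB x y ≡ true → x Fin.< y
ltB⇒< {x = x} {y} = witness (x Fin.<? y)

-- unlike eqB, this computes: suc x ≡ᵇ suc y reduces to x ≡ᵇ y, which edge counting relies on
_≡ᵇ_ : ∀ {n} → Fin n → Fin n → Bool
zero  ≡ᵇ zero  = true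
zero  ≡ᵇ suc _ = false
suc _ ≡ᵇ zero  = false
suc x ≡ᵇ suc y = x ≡ᵇ y

≡ᵇ⇒≡ : ∀ {n} {x y : Fin n} → x ≡ᵇ y ≡ true → x ≡ y
≡ᵇ⇒≡ {x = zero}  {zero}  _ = refl
≡ᵇ⇒≡ {x = suc x} {suc y} q = cong suc (≡ᵇ⇒≡ q)

≡⇒≡ᵇ : ∀ {n} {x y : Fin n} → x ≡ y → x ≡ᵇ y ≡ true
≡⇒≡ᵇ {x = zero}  refl = refl
≡⇒≡ᵇ {x = suc x} refl = ≡⇒≡ᵇ {x = x} refl

toℕ<⇒≢fromℕ : ∀ {m} {x : Fin (suc m)} → toℕ x ℕ.< m → x ≢ fromℕ m
toℕ<⇒≢fromℕ {m} x<m refl = ℕ.<-irrefl (Fin.toℕ-fromℕ m) x<m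

≢fromℕ⇒toℕ< : ∀ {m} {x : Fin (suc m)} → x ≢ fromℕ m → toℕ x ℕ.< m
≢fromℕ⇒toℕ< {m} {x} x≢m =
  ℕ.≤∧≢⇒< (Fin.toℕ≤pred[n] x) λ x≡m →
    x≢m (Fin.toℕ-injective (trans x≡m (sym (Fin.toℕ-fromℕ m))))

<⇒≢fromℕ : ∀ {m} {x y : Fin (suc m)} → x Fin.< y → x ≢ fromℕ m
<⇒≢fromℕ {y = y} x<y refl = ℕ.<-irrefl refl (ℕ.<-≤-trans x<y (Fin.≤fromℕ y))

anyFin⁻ : ∀ {n} (f : Fin n → Bool) → anyFin f ≡ true → ∃ λ i → f i ≡ true
anyFin⁻ {suc n} f q with ∨-true⁻ {f zero} q
... | inj₁ f0 = zero , f0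
... | inj₂ fs = let i , fi = anyFin⁻ (f ∘ suc) fs in suc i , fi

anyFin⁺ : ∀ {n} (f : Fin n → Bool) i → f i ≡ true → anyFin f ≡ true
anyFin⁺ f zero    fi = ∨-trueˡ _ fi
anyFin⁺ f (suc i) fi = ∨-trueʳ (f zero) (anyFin⁺ (f ∘ suc) i fi)

anyFin-cong : ∀ {n} {f g : Fin n → Bool} → (∀ i → f i ≡ g i) → anyFin f ≡ anyFin g
anyFin-cong {zero}  _ = refl
anyFin-cong {suc n} f≗g = cong₂ _∨_ (f≗g zero) (anyFin-cong (f≗g ∘ suc))

countFin-cong : ∀ {n} {f g : Fin n → Bool} → (∀ i → f i ≡ g i) → countFin f ≡ countFin g
countFin-cong f≗g = cong ∣_∣ (tabulate-cong f≗g)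

countFin-head : ∀ {n} (f : Fin (suc n) → Bool) →
                countFin f ≡ (if f zero then 1 else 0) + countFin (f ∘ suc)
countFin-head f with f zero
... | true  = refl
... | false = refl

countFin-mono : ∀ {n} {f g : Fin n → Bool} → (∀ i → f i ≡ true → g i ≡ true) →
                countFin f ℕ.≤ countFin g
countFin-mono {f = f} {g} f⇒g = p⊆q⇒∣p∣≤∣q∣ {p = tabulate f} {q = tabulate g} λ {i} i∈f →
  lookup⇒[]= i (tabulate g)
    (trans (lookup∘tabulate g i) (f⇒g i (trans (sym (lookup∘tabulate f i)) ([]=⇒lookup i∈f))))

countFin-false : ∀ {n} (f : Fin n → Bool) → (∀ i → f i ≡ false) → countFin f ≡ 0
countFin-false {zero}  f _   = refl
countFin-false {suc n} f off rewrite countFin-head f | off zero = countFin-false (f ∘ suc) (off ∘ suc)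

countFin-true : ∀ {n} (f : Fin n → Bool) → (∀ i → f i ≡ true) → countFin f ≡ n
countFin-true {zero}  f _  = refl
countFin-true {suc n} f on rewrite countFin-head f | on zero =
  cong suc (countFin-true (f ∘ suc) (on ∘ suc))

countFin-≡ᵇ : ∀ {n} (u : Fin n) → countFin (_≡ᵇ u) ≡ 1
countFin-≡ᵇ {suc n} zero    = cong suc (countFin-false {n} _ λ _ → refl)
countFin-≡ᵇ {suc n} (suc u) = countFin-≡ᵇ u

countFin-ltB : ∀ {n} (i : Fin n) → countFin (ltB i) ≡ n ∸ suc (toℕ i)
countFin-ltB {suc n} zero    = countFin-true (λ j → ltB zero (suc j)) λ _ → refl
countFin-ltB {suc n} (suc i) = trans (countFin-cong {f = λ j → ltB (suc i) (suc j)} {ltB i} λ j →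
  trans (isYes≗does (suc i Fin.<? suc j)) (sym (isYes≗does (i Fin.<? j)))) (countFin-ltB i)

AtMostOne : ∀ {n} → (Fin n → Bool) → Set
AtMostOne f = ∀ i j → f i ≡ true → f j ≡ true → i ≡ j

countFin-atMostOne : ∀ {n} (f : Fin n → Bool) → AtMostOne f → countFin f ℕ.≤ 1
countFin-atMostOne {zero}  f _   = z≤n
countFin-atMostOne {suc n} f one rewrite countFin-head f with f zero in f0
... | true  = s≤s (ℕ.≤-reflexive (countFin-false (f ∘ suc) λ i →
                ¬-not λ fi → Fin.0≢1+n (one zero (suc i) f0 fi)))
... | false = countFin-atMostOne (f ∘ suc) λ i j fi fj → Fin.suc-injective (one (suc i) (suc j) fi fj)

countFin-∪ : ∀ {n} (f g h : Fin n → Bool) → (∀ i → f i ≡ true → g i ≡ true ⊎ h i ≡ true) →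
             countFin f ℕ.≤ countFin g + countFin h
countFin-∪ {zero}  f g h _ = z≤n
countFin-∪ {suc n} f g h cover
  rewrite countFin-head f | countFin-head g | countFin-head h
  with f zero | g zero | h zero | cover zero | countFin-∪ (f ∘ suc) (g ∘ suc) (h ∘ suc) (cover ∘ suc)
... | false | g0    | h0    | _ | IH =
  ℕ.≤-trans IH (ℕ.+-mono-≤ (ℕ.m≤n+m _ (if g0 then 1 else 0)) (ℕ.m≤n+m _ (if h0 then 1 else 0)))
... | true  | true  | h0    | _ | IH =
  s≤s (ℕ.≤-trans IH (ℕ.+-monoʳ-≤ (countFin (g ∘ suc)) (ℕ.m≤n+m _ (if h0 then 1 else 0))))
... | true  | false | true  | _ | IH =
  ℕ.≤-trans (s≤s IH) (ℕ.≤-reflexive (sym (ℕ.+-suc (countFin (g ∘ suc)) _)))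
... | true  | false | false | c | _ with c refl
...   | inj₁ ()
...   | inj₂ ()

-- Boxes have the normal fan of the cube

toℚ≡mkℚ : ∀ k → toℚ k ≡ mkℚ (ℤ.+ k) 0 (λ (_ , d∣1) → ∣1⇒≡1 d∣1)
toℚ≡mkℚ k = ℚ.normalize-coprime _

toℚ-mono-≤ : ∀ {j k} → j ℕ.≤ k → toℚ j ℚ.≤ toℚ k
toℚ-mono-≤ {j} {k} j≤k rewrite toℚ≡mkℚ j | toℚ≡mkℚ k =
  *≤* (subst₂ ℤ._≤_ (sym (ℤ.*-identityʳ (ℤ.+ j))) (sym (ℤ.*-identityʳ (ℤ.+ k))) (ℤ.+≤+ j≤k))

toℚ-mono-< : ∀ {j k} → j ℕ.< k → toℚ j ℚ.< toℚ k
toℚ-mono-< {j} {k} j<k rewrite toℚ≡mkℚ j | toℚ≡mkℚ k =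
  *<* (subst₂ ℤ._<_ (sym (ℤ.*-identityʳ (ℤ.+ j))) (sym (ℤ.*-identityʳ (ℤ.+ k))) (ℤ.+<+ j<k))

scale-mono : ∀ r {j k} → (0ℚ ℚ.< r → j ℕ.≤ k) → (r ℚ.< 0ℚ → k ℕ.≤ j) →
             r ℚ.* toℚ j ℚ.≤ r ℚ.* toℚ k
scale-mono r {j} {k} pos neg with ℚ.<-cmp r 0ℚ
... | tri< r<0 _ _  = ℚ.*-monoˡ-≤-nonPos r {{ℚ.nonPositive (ℚ.<⇒≤ r<0)}} (toℚ-mono-≤ (neg r<0))
... | tri≈ _ refl _ = ℚ.≤-reflexive (trans (ℚ.*-zeroˡ (toℚ j)) (sym (ℚ.*-zeroˡ (toℚ k))))
... | tri> _ _ 0<r  = ℚ.*-monoˡ-≤-nonNeg r {{ℚ.nonNegative (ℚ.<⇒≤ 0<r)}} (toℚ-mono-≤ (pos 0<r))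

scale-mono-< : ∀ r {j k} → r ≢ 0ℚ → j ≢ k →
               (0ℚ ℚ.< r → j ℕ.≤ k) → (r ℚ.< 0ℚ → k ℕ.≤ j) →
               r ℚ.* toℚ j ℚ.< r ℚ.* toℚ k
scale-mono-< r r≢0 j≢k pos neg with ℚ.<-cmp r 0ℚ
... | tri< r<0 _ _  =
  ℚ.*-monoʳ-<-neg r {{ℚ.negative r<0}} (toℚ-mono-< (ℕ.≤∧≢⇒< (neg r<0) (j≢k ∘ sym)))
... | tri≈ _ r≡0 _  = ⊥-elim (r≢0 r≡0)
... | tri> _ _ 0<r  =
  ℚ.*-monoʳ-<-pos r {{ℚ.positive 0<r}} (toℚ-mono-< (ℕ.≤∧≢⇒< (pos 0<r) j≢k))

sumFin-mono : ∀ {m} {f g : Fin m → ℚ} → (∀ i → f i ℚ.≤ g i) → sumFin f ℚ.≤ sumFin g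
sumFin-mono {zero}  _   = ℚ.≤-refl
sumFin-mono {suc m} f≤g = ℚ.+-mono-≤ (f≤g zero) (sumFin-mono (f≤g ∘ suc))

sumFin-mono-< : ∀ {m} {f g : Fin m → ℚ} → (∀ i → f i ℚ.≤ g i) → ∀ i → f i ℚ.< g i →
                sumFin f ℚ.< sumFin g
sumFin-mono-< f≤g zero    fi<gi = ℚ.+-mono-<-≤ fi<gi (sumFin-mono (f≤g ∘ suc))
sumFin-mono-< f≤g (suc i) fi<gi = ℚ.+-mono-≤-< (f≤g zero) (sumFin-mono-< (f≤g ∘ suc) i fi<gi)

corner : ∀ {m} → Point m → (Fin m → Bool) → Point m
corner b σ i = if σ i then b i else 0

record HullIsBox {m} (S : PointSet m) (b : Point m) : Set where
  field
    positive : ∀ i → 0 ℕ.< b i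
    bounded  : ∀ {x} → S x → ∀ i → x i ℕ.≤ b i
    corners  : ∀ σ → S (corner b σ)

Extremal : ∀ {m} → Point m → (Fin m → ℚ) → Point m → Set
Extremal b w x = ∀ i → (0ℚ ℚ.< w i → x i ≡ b i) × (w i ℚ.< 0ℚ → x i ≡ 0)

SameSigns : ∀ {m} → (Fin m → ℚ) → (Fin m → ℚ) → Set
SameSigns w w' = ∀ i → ((0ℚ ℚ.< w i → 0ℚ ℚ.< w' i) × (0ℚ ℚ.< w' i → 0ℚ ℚ.< w i))
                     × ((w i ℚ.< 0ℚ → w' i ℚ.< 0ℚ) × (w' i ℚ.< 0ℚ → w i ℚ.< 0ℚ))

module _ {m} {S : PointSet m} {b : Point m} (box : HullIsBox S b) where
  open HullIsBox box

  extremal-dominates : ∀ w {x y} → Extremal b w x → S y →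
                       ∀ i → (0ℚ ℚ.< w i → y i ℕ.≤ x i) × (w i ℚ.< 0ℚ → x i ℕ.≤ y i)
  extremal-dominates w {x} {y} ext Sy i =
      (λ 0<w → subst (y i ℕ.≤_) (sym (proj₁ (ext i) 0<w)) (bounded Sy i))
    , (λ w<0 → subst (ℕ._≤ y i) (sym (proj₂ (ext i) w<0)) z≤n)

  extremal⇒inFace : ∀ w {x} → S x → Extremal b w x → InFace S w x
  extremal⇒inFace w Sx ext = Sx , λ y Sy → sumFin-mono λ i →
    let y≤x , x≤y = extremal-dominates w ext Sy i in scale-mono (w i) y≤x x≤y

  -- two maximisers of w, differing exactly where w vanishes
  lowCorner highCorner : (Fin m → ℚ) → Point m
  lowCorner  w = corner b (λ i → isYes (0ℚ ℚ.<? w i))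
  highCorner w = corner b (λ i → not (isYes (w i ℚ.<? 0ℚ)))

  lowCorner-extremal : ∀ w → Extremal b w (lowCorner w)
  lowCorner-extremal w i with 0ℚ ℚ.<? w i
  ... | yes 0<w = (λ _ → refl) , λ w<0 → ⊥-elim (ℚ.<-asym 0<w w<0)
  ... | no  0≮w = (λ 0<w → ⊥-elim (0≮w 0<w)) , λ _ → refl

  highCorner-extremal : ∀ w → Extremal b w (highCorner w)
  highCorner-extremal w i with w i ℚ.<? 0ℚ
  ... | yes w<0 = (λ 0<w → ⊥-elim (ℚ.<-asym 0<w w<0)) , λ _ → refl
  ... | no  w≮0 = (λ _ → refl) , λ w<0 → ⊥-elim (w≮0 w<0)

  inFace⇒extremal : ∀ w {x} → InFace S w x → Extremal b w x
  inFace⇒extremal w {x} (Sx , max) i =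
      (λ 0<w → trans (agrees (ℚ.<⇒≢ 0<w ∘ sym)) (proj₁ (lowCorner-extremal w i) 0<w))
    , (λ w<0 → trans (agrees (ℚ.<⇒≢ w<0)) (proj₂ (lowCorner-extremal w i) w<0))
    where
    dominated = extremal-dominates w (lowCorner-extremal w) Sx
    agrees : w i ≢ 0ℚ → x i ≡ lowCorner w i
    agrees w≢0 with x i ℕ.≟ lowCorner w i
    ... | yes x≡c = x≡c
    ... | no  x≢c = ⊥-elim (ℚ.<-irrefl refl (ℚ.<-≤-trans
          (sumFin-mono-< (λ j → scale-mono (w j) (proj₁ (dominated j)) (proj₂ (dominated j))) i
                         (scale-mono-< (w i) w≢0 x≢c (proj₁ (dominated i)) (proj₂ (dominated i))))
          (max (lowCorner w) (corners _))))

  sameFace⇒extremal : ∀ v v' {c} → SameFace S v v' → S c → Extremal b v' c → Extremal b v c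
  sameFace⇒extremal v v' same Sc ext = inFace⇒extremal v (proj₂ (same _) (extremal⇒inFace v' Sc ext))

  sameFace⇒sameSigns : ∀ w w' → SameFace S w w' → SameSigns w w'
  sameFace⇒sameSigns w w' same i =
      (positive⇒ w w' same , positive⇒ w' w (swap ∘ same))
    , (negative⇒ w w' same , negative⇒ w' w (swap ∘ same))
    where
    b≢0 : b i ≢ 0
    b≢0 = ℕ.m<n⇒n≢0 (positive i)
    positive⇒ : ∀ v v' → SameFace S v v' → 0ℚ ℚ.< v i → 0ℚ ℚ.< v' i
    positive⇒ v v' same' 0<v
      with 0ℚ ℚ.<? v' i | proj₁ (sameFace⇒extremal v v' same' (corners _) (lowCorner-extremal v') i) 0<v
    ... | yes 0<v' | _   = 0<v'
    ... | no  _    | 0≡b = ⊥-elim (b≢0 (sym 0≡b))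
    negative⇒ : ∀ v v' → SameFace S v v' → v i ℚ.< 0ℚ → v' i ℚ.< 0ℚ
    negative⇒ v v' same' v<0
      with v' i ℚ.<? 0ℚ | proj₂ (sameFace⇒extremal v v' same' (corners _) (highCorner-extremal v') i) v<0
    ... | yes v'<0 | _   = v'<0
    ... | no  _    | b≡0 = ⊥-elim (b≢0 b≡0)

  sameSigns⇒sameFace : ∀ w w' → SameSigns w w' → SameFace S w w'
  sameSigns⇒sameFace w w' same x =
      transfer w w' (λ i → proj₂ (proj₁ (same i))) (λ i → proj₂ (proj₂ (same i)))
    , transfer w' w (λ i → proj₁ (proj₁ (same i))) (λ i → proj₁ (proj₂ (same i)))
    where
    transfer : ∀ v v' → (∀ i → 0ℚ ℚ.< v' i → 0ℚ ℚ.< v i) →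
               (∀ i → v' i ℚ.< 0ℚ → v i ℚ.< 0ℚ) → InFace S v x → InFace S v' x
    transfer v v' pos neg face = extremal⇒inFace v' (proj₁ face) λ i →
      let top , bottom = inFace⇒extremal v face i in top ∘ pos i , bottom ∘ neg i

hullIsBox⇒normallyEquivalent : ∀ {m} {S S' : PointSet m} {b b'} →
                               HullIsBox S b → HullIsBox S' b' → NormallyEquivalent S S'
hullIsBox⇒normallyEquivalent box box' w w' =
    sameSigns⇒sameFace box' w w' ∘ sameFace⇒sameSigns box w w'
  , sameSigns⇒sameFace box w w' ∘ sameFace⇒sameSigns box' w w'

cube-hullIsBox : ∀ {m} → HullIsBox (cubeVertices {m}) (λ _ → 1)
cube-hullIsBox = record
  { positive = λ _ → s≤s z≤n
  ; bounded  = λ x∈cube i →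
      [ (λ x≡0 → subst (ℕ._≤ 1) (sym x≡0) z≤n) , ℕ.≤-reflexive ]′ (x∈cube i)
  ; corners  = λ σ i → bit (σ i)
  }
  where
  bit : ∀ β → ((if β then 1 else 0) ≡ 0) ⊎ ((if β then 1 else 0) ≡ 1)
  bit true  = inj₂ refl
  bit false = inj₁ refl

-- Increasing trees

-- node b t T puts a new vertex 0 below the vertices of T (shifted by one) and joins it to t,
-- as a parent of t if b holds and as a child of t otherwise.  The root is the last vertex.
data IncreasingTree : ℕ → Set where
  root : IncreasingTree zero
  node : ∀ {m} → Bool → Fin (suc m) → IncreasingTree m → IncreasingTree (suc m)

extend : ∀ {n} → (Fin (suc n) → Bool) → (Fin n → Bool) → Graph n → Graph (suc n)
extend row col G zero    y       = row y
extend row col G (suc x) zero    = col x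
extend row col G (suc x) (suc y) = G x y

graph : ∀ {m} → IncreasingTree m → Graph (suc m)
graph root         = λ _ _ → false
graph (node b t T) = extend (λ y → not b ∧ (y ≡ᵇ suc t)) (λ x → b ∧ (x ≡ᵇ t)) (graph T)

above : ∀ {m} → IncreasingTree m → Fin (suc m) → Fin (suc m)
above root         x       = x
above (node b t T) zero    = suc t
above (node b t T) (suc x) = suc (above T x)

isParent : ∀ {m} → IncreasingTree m → Fin (suc m) → Bool
isParent root         _       = false
isParent (node b t T) zero    = b
isParent (node b t T) (suc x) = isParent T x

above-increasing : ∀ {m} (T : IncreasingTree m) {x} → x ≢ fromℕ m → toℕ x ℕ.< toℕ (above T x)
above-increasing root         {zero}  x≢root = ⊥-elim (x≢root refl)
above-increasing (node b t T) {zero}  _      = s≤s z≤n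
above-increasing (node b t T) {suc x} x≢root = s≤s (above-increasing T (x≢root ∘ cong suc))

-- edgeCount sums with a function local to Defs, so it can be evaluated but not reasoned about by
-- induction.  The edge from t up to a new parent vertex 0 is the entry of row t in column 0; it is
-- absorbed by evaluation only while it slides down past vertices with empty columns, that is, past
-- vertices that are children of their neighbour above.
ChildrenBelow : ∀ {m} → Fin (suc m) → IncreasingTree m → Set
ChildrenBelow zero    T            = ⊤
ChildrenBelow (suc t) (node b _ T) = b ≡ false × ChildrenBelow t T

WellFormed : ∀ {m} → IncreasingTree m → Set
WellFormed root         = ⊤
WellFormed (node b t T) = (b ≡ true → ChildrenBelow t T) × WellFormed T

edgeCount-parentOf : ∀ {m} (row : Fin (suc (suc m)) → Bool) t (T : IncreasingTree m) →
                     ChildrenBelow t T →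
                     edgeCount (extend row (_≡ᵇ t) (graph T)) ≡ countFin row + suc (edgeCount (graph T))
edgeCount-parentOf row zero    T            _              = refl
edgeCount-parentOf row (suc t) (node _ u T) (refl , below) = cong (countFin row +_) (begin
  edgeCount (extend (_≡ᵇ suc u) (_≡ᵇ t) (graph T)) ≡⟨ edgeCount-parentOf (_≡ᵇ suc u) t T below ⟩
  countFin (_≡ᵇ suc u) + suc (edgeCount (graph T)) ≡⟨ ℕ.+-suc _ _ ⟩
  suc (countFin (_≡ᵇ suc u) + edgeCount (graph T)) ∎)
  where open ≡-Reasoning

edgeCount-graph : ∀ {m} (T : IncreasingTree m) → WellFormed T → edgeCount (graph T) ≡ m
edgeCount-graph         root             _            = refl
edgeCount-graph         (node false t T) (_ , wf)     =
  cong₂ _+_ (countFin-≡ᵇ (suc t)) (edgeCount-graph T wf)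
edgeCount-graph {suc m} (node true t T)  (below , wf) =
  trans (edgeCount-parentOf (λ _ → false) t T (below refl))
        (cong₂ (λ a b → a + suc b) (countFin-false {suc (suc m)} _ λ _ → refl) (edgeCount-graph T wf))

graph-irreflexive : ∀ {m} (T : IncreasingTree m) x → graph T x x ≡ false
graph-irreflexive root         _       = refl
graph-irreflexive (node b t T) zero    = ∧-zeroʳ (not b)
graph-irreflexive (node b t T) (suc x) = graph-irreflexive T x

graph-asymmetric : ∀ {m} (T : IncreasingTree m) x y → graph T x y ≡ true → graph T y x ≡ false
graph-asymmetric (node false t T) zero    (suc y) _ = refl
graph-asymmetric (node true  t T) (suc x) zero    _ = refl
graph-asymmetric (node b     t T) (suc x) (suc y) q = graph-asymmetric T x y q

data ChildOf {m} (T : IncreasingTree m) (x y : Fin (suc m)) : Set where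
  parentAbove : x ≢ fromℕ m → isParent T x ≡ false → above T x ≡ y → ChildOf T x y
  parentBelow : y ≢ fromℕ m → isParent T y ≡ true  → above T y ≡ x → ChildOf T x y

module _ {m} {b : Bool} {t : Fin (suc m)} {T : IncreasingTree m} {x y : Fin (suc m)} where

  childOf-suc : ChildOf T x y → ChildOf (node b t T) (suc x) (suc y)
  childOf-suc (parentAbove x≢root isX x↑y) = parentAbove (x≢root ∘ Fin.suc-injective) isX (cong suc x↑y)
  childOf-suc (parentBelow y≢root isY y↑x) = parentBelow (y≢root ∘ Fin.suc-injective) isY (cong suc y↑x)

  childOf-pred : ChildOf (node b t T) (suc x) (suc y) → ChildOf T x y
  childOf-pred (parentAbove x≢root isX x↑y) = parentAbove (x≢root ∘ cong suc) isX (Fin.suc-injective x↑y)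
  childOf-pred (parentBelow y≢root isY y↑x) = parentBelow (y≢root ∘ cong suc) isY (Fin.suc-injective y↑x)

graph⇒childOf : ∀ {m} (T : IncreasingTree m) x y → graph T x y ≡ true → ChildOf T x y
graph⇒childOf (node false t T) zero    (suc y) q = parentAbove (λ ()) refl (cong suc (sym (≡ᵇ⇒≡ q)))
graph⇒childOf (node true  t T) (suc x) zero    q = parentBelow (λ ()) refl (cong suc (sym (≡ᵇ⇒≡ q)))
graph⇒childOf (node b     t T) (suc x) (suc y) q = childOf-suc (graph⇒childOf T x y q)

childOf⇒graph : ∀ {m} (T : IncreasingTree m) x y → ChildOf T x y → graph T x y ≡ true
childOf⇒graph root              zero    zero    (parentAbove x≢root _ _) = ⊥-elim (x≢root refl)
childOf⇒graph root              zero    zero    (parentBelow y≢root _ _) = ⊥-elim (y≢root refl)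
childOf⇒graph (node .false t T) zero    (suc y) (parentAbove _ refl 0↑y) = ≡⇒≡ᵇ (Fin.suc-injective (sym 0↑y))
childOf⇒graph (node b      t T) zero    zero    (parentBelow _ _ ())
childOf⇒graph (node b      t T) zero    (suc y) (parentBelow _ _ ())
childOf⇒graph (node .true  t T) (suc x) zero    (parentBelow _ refl 0↑x) = ≡⇒≡ᵇ (Fin.suc-injective (sym 0↑x))
childOf⇒graph (node b      t T) (suc x) (suc y) c = childOf⇒graph T x y (childOf-pred c)

-- Walks and components

module _ {n} (E : Graph n) (ok : Fin n → Bool) where

  -- walks of length at most k all of whose vertices after the first satisfy ok
  walk : ℕ → Fin n → Fin n → Bool
  walk zero    x y = eqB x y
  walk (suc k) x y = walk k x y ∨ anyFin (λ z → walk k x z ∧ adj E z y ∧ ok y)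

  walk-suc : ∀ k {x y} → walk k x y ≡ true → walk (suc k) x y ≡ true
  walk-suc k = ∨-trueˡ _

  walk-≤ : ∀ {k} l {x y} → k ℕ.≤ l → walk k x y ≡ true → walk l x y ≡ true
  walk-≤ zero    z≤n w = w
  walk-≤ (suc l) k≤l w with ℕ.m≤n⇒m<n∨m≡n k≤l
  ... | inj₂ refl      = w
  ... | inj₁ (s≤s k≤l) = walk-suc l (walk-≤ l k≤l w)

  walk-refl : ∀ k x → walk k x x ≡ true
  walk-refl zero    x = ≡⇒eqB refl
  walk-refl (suc k) x = walk-suc k (walk-refl k x)

  walk-snoc : ∀ k {x z y} → walk k x z ≡ true → adj E z y ≡ true → ok y ≡ true →
              walk (suc k) x y ≡ true
  walk-snoc k {x} {z} {y} w zy oy = ∨-trueʳ (walk k x y)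
    (anyFin⁺ (λ z → walk k x z ∧ adj E z y ∧ ok y) z (∧-true⁺ w (∧-true⁺ zy oy)))

  walk-last : ∀ k {x y} → walk (suc k) x y ≡ true →
              walk k x y ≡ true ⊎ ∃ λ z → walk k x z ≡ true × adj E z y ≡ true × ok y ≡ true
  walk-last k {x} {y} w with ∨-true⁻ {walk k x y} w
  ... | inj₁ w' = inj₁ w'
  ... | inj₂ viaSome with anyFin⁻ _ viaSome
  ...   | z , lastStep with ∧-true⁻ {walk k x z} lastStep
  ...     | w' , zy∧oy = inj₂ (z , w' , ∧-true⁻ zy∧oy)

  walk-cons : ∀ k {x z y} → ok z ≡ true → adj E x z ≡ true → walk k z y ≡ true →
              walk (suc k) x y ≡ true
  walk-cons zero    oz xz w rewrite eqB⇒≡ w = walk-snoc zero (walk-refl zero _) xz oz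
  walk-cons (suc k) oz xz w = [ walk-suc (suc k) ∘ walk-cons k oz xz
                              , (λ (_ , w' , uy , oy) → walk-snoc (suc k) (walk-cons k oz xz w') uy oy)
                              ]′ (walk-last k w)

  walk-closed : ∀ (P : Fin n → Set) {x} → P x →
                (∀ {z y} → P z → adj E z y ≡ true → ok y ≡ true → P y) →
                ∀ k {y} → walk k x y ≡ true → P y
  walk-closed P Px closed zero    w = subst P (eqB⇒≡ w) Px
  walk-closed P Px closed (suc k) w =
    [ walk-closed P Px closed k
    , (λ (_ , w' , zy , oy) → closed (walk-closed P Px closed k w') zy oy)
    ]′ (walk-last k w)

module _ {n} (E : Graph n) where

  reachW≡walk : ∀ v k x y → reachW E v k x y ≡ walk E (λ y → not (eqB y v)) k x y
  reachW≡walk v zero    x y = refl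
  reachW≡walk v (suc k) x y = cong₂ _∨_ (reachW≡walk v k x y)
    (anyFin-cong λ z → cong (_∧ (adj E z y ∧ not (eqB y v))) (reachW≡walk v k x z))

  reachAll≡walk : ∀ k x y → reachAll E k x y ≡ walk E (λ _ → true) k x y
  reachAll≡walk zero    x y = refl
  reachAll≡walk (suc k) x y = cong₂ _∨_ (reachAll≡walk k x y)
    (anyFin-cong λ z → cong₂ _∧_ (reachAll≡walk k x z) (sym (∧-identityʳ (adj E z y))))

UpStep : ∀ {m} → IncreasingTree m → Fin (suc m) → Fin (suc m) → Set
UpStep {m} T x y = x ≢ fromℕ m × above T x ≡ y

data UpPath {m} (T : IncreasingTree m) : Fin (suc m) → Fin (suc m) → Set where
  here : ∀ {v} → UpPath T v v
  step : ∀ {y v} → y ≢ fromℕ m → UpPath T (above T y) v → UpPath T y v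

module _ {m} (T : IncreasingTree m) where

  private
    E = graph T

  adj⇒upStep : ∀ {x y} → adj E x y ≡ true → UpStep T x y ⊎ UpStep T y x
  adj⇒upStep {x} {y} xy with ∨-true⁻ {E x y} xy
  ... | inj₁ x→y with graph⇒childOf T x y x→y
  ...   | parentAbove x≢root _ x↑y = inj₁ (x≢root , x↑y)
  ...   | parentBelow y≢root _ y↑x = inj₂ (y≢root , y↑x)
  adj⇒upStep {x} {y} xy | inj₂ y→x with graph⇒childOf T y x y→x
  ...   | parentAbove y≢root _ y↑x = inj₂ (y≢root , y↑x)
  ...   | parentBelow x≢root _ x↑y = inj₁ (x≢root , x↑y)

  adj-above : ∀ {x} → x ≢ fromℕ m → adj E x (above T x) ≡ true
  adj-above {x} x≢root with isParent T x in isX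
  ... | false = ∨-trueˡ _ (childOf⇒graph T _ _ (parentAbove x≢root isX refl))
  ... | true  = ∨-trueʳ (E x (above T x)) (childOf⇒graph T _ _ (parentBelow x≢root isX refl))

  adj-below : ∀ {x} → x ≢ fromℕ m → adj E (above T x) x ≡ true
  adj-below {x} x≢root = trans (∨-comm (E (above T x) x) _) (adj-above x≢root)

  upPath-≤ : ∀ {y v} → UpPath T y v → toℕ y ℕ.≤ toℕ v
  upPath-≤ here               = ℕ.≤-refl
  upPath-≤ (step y≢root path) = ℕ.<⇒≤ (ℕ.<-≤-trans (above-increasing T y≢root) (upPath-≤ path))

  walk-upper : ∀ ok ℓ d → ℓ + d ≡ m → (∀ z → ℓ ℕ.≤ toℕ z → ok z ≡ true) →
               ∀ {x y} → ℓ ℕ.≤ toℕ x → ℓ ℕ.≤ toℕ y → walk E ok d x y ≡ true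
  walk-upper ok ℓ zero ℓ≡m _ {x} {y} ℓ≤x ℓ≤y =
    subst (λ z → walk E ok 0 x z ≡ true) (Fin.toℕ-injective (trans (atRoot ℓ≤x) (sym (atRoot ℓ≤y))))
          (walk-refl E ok 0 x)
    where
    atRoot : ∀ {z} → ℓ ℕ.≤ toℕ z → toℕ z ≡ m
    atRoot ℓ≤z = ℕ.≤-antisym (Fin.toℕ≤pred[n] _)
                             (subst (ℕ._≤ _) (trans (sym (ℕ.+-identityʳ ℓ)) ℓ≡m) ℓ≤z)
  walk-upper ok ℓ (suc d) ℓ+d≡m okh {x} {y} ℓ≤x ℓ≤y =
    cases (ℕ.m≤n⇒m<n∨m≡n ℓ≤x) (ℕ.m≤n⇒m<n∨m≡n ℓ≤y)
    where
    IH : ∀ {x y} → ℓ ℕ.< toℕ x → ℓ ℕ.< toℕ y → walk E ok d x y ≡ true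
    IH = walk-upper ok (suc ℓ) d (trans (sym (ℕ.+-suc ℓ d)) ℓ+d≡m) λ z ℓ<z → okh z (ℕ.<⇒≤ ℓ<z)
    lowest≢root : ∀ {z} → ℓ ≡ toℕ z → z ≢ fromℕ m
    lowest≢root refl = toℕ<⇒≢fromℕ (subst (ℓ ℕ.<_) ℓ+d≡m (ℕ.m<m+n ℓ (s≤s z≤n)))
    ℓ<above : ∀ {z} → ℓ ≡ toℕ z → ℓ ℕ.< toℕ (above T z)
    ℓ<above ℓ≡z = subst (ℕ._< _) (sym ℓ≡z) (above-increasing T (lowest≢root ℓ≡z))
    cases : ℓ ℕ.< toℕ x ⊎ ℓ ≡ toℕ x → ℓ ℕ.< toℕ y ⊎ ℓ ≡ toℕ y →
            walk E ok (suc d) x y ≡ true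
    cases (inj₁ ℓ<x) (inj₁ ℓ<y) = walk-suc E ok d (IH ℓ<x ℓ<y)
    cases (inj₂ ℓ≡x) (inj₁ ℓ<y) =
      walk-cons E ok d (okh _ (ℕ.<⇒≤ (ℓ<above ℓ≡x))) (adj-above (lowest≢root ℓ≡x))
                       (IH (ℓ<above ℓ≡x) ℓ<y)
    cases (inj₁ ℓ<x) (inj₂ ℓ≡y) =
      walk-snoc E ok d (IH ℓ<x (ℓ<above ℓ≡y)) (adj-below (lowest≢root ℓ≡y)) (okh y ℓ≤y)
    cases (inj₂ ℓ≡x) (inj₂ ℓ≡y) =
      subst (λ z → walk E ok (suc d) x z ≡ true) (Fin.toℕ-injective (trans (sym ℓ≡x) ℓ≡y))
            (walk-refl E ok (suc d) x)

  graph-connected : ∀ x y → reachAll E (suc m) x y ≡ true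
  graph-connected x y = trans (reachAll≡walk E (suc m) x y)
    (walk-suc E _ m (walk-upper (λ _ → true) 0 m refl (λ _ _ → refl) z≤n z≤n))

  reach-upper : ∀ {v j} → v ≢ fromℕ m → toℕ v ℕ.< toℕ j → InComp E v (above T v) j
  reach-upper {v} {j} v≢root v<j = trans (reachW≡walk E v (suc m) (above T v) j)
    (walk-≤ E _ (suc m) (ℕ.≤-trans (ℕ.m∸n≤m m (suc (toℕ v))) (ℕ.n≤1+n m))
      (walk-upper _ (suc (toℕ v)) (m ∸ suc (toℕ v)) (ℕ.m+[n∸m]≡n (≢fromℕ⇒toℕ< v≢root))
                  avoids (above-increasing T v≢root) v<j))
    where
    avoids : ∀ z → toℕ v ℕ.< toℕ z → not (eqB z v) ≡ true
    avoids z v<z = cong not (≢⇒eqB λ { refl → ℕ.<-irrefl refl v<z })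

  reachW-closed : ∀ (P : Fin (suc m) → Set) {v x} → P x →
                  (∀ {z y} → P z → UpStep T z y ⊎ UpStep T y z → y ≢ v → P y) →
                  ∀ {y} → InComp E v x y → P y
  reachW-closed P {v} {x} Px closed {y} r =
    walk-closed E _ P Px (λ Pz zy y≢v → closed Pz (adj⇒upStep zy) (not-eqB⇒≢ y≢v)) (suc m)
                (trans (sym (reachW≡walk E v (suc m) x y)) r)

  component-below : ∀ {x v} → x ≢ fromℕ m → above T x ≡ v → ∀ {j} → InComp E v x j → UpPath T j x
  component-below {x} {v} x≢root x↑v = reachW-closed (λ y → UpPath T y x) here closed
    where
    closed : ∀ {z y} → UpPath T z x → UpStep T z y ⊎ UpStep T y z → y ≢ v → UpPath T y x
    closed here          (inj₁ (_ , refl))      y≢v = ⊥-elim (y≢v x↑v)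
    closed (step _ path) (inj₁ (_ , refl))      _   = path
    closed path          (inj₂ (y≢root , refl)) _   = step y≢root path

  component-below-< : ∀ {x v} → x ≢ fromℕ m → above T x ≡ v →
                      ∀ {j} → InComp E v x j → toℕ j ℕ.< toℕ v
  component-below-< x≢root refl r =
    ℕ.≤-<-trans (upPath-≤ (component-below x≢root refl r)) (above-increasing T x≢root)

  component-above : ∀ {v} → v ≢ fromℕ m → ∀ {j} → InComp E v (above T v) j → ¬ UpPath T j v
  component-above {v} v≢root = reachW-closed (λ y → ¬ UpPath T y v) notBelow closed
    where
    notBelow : ¬ UpPath T (above T v) v
    notBelow path = ℕ.<-irrefl refl (ℕ.<-≤-trans (above-increasing T v≢root) (upPath-≤ path))
    closed : ∀ {z y} → ¬ UpPath T z v → UpStep T z y ⊎ UpStep T y z → y ≢ v → ¬ UpPath T y v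
    closed ¬z (inj₁ (z≢root , refl)) _   path          = ¬z (step z≢root path)
    closed ¬z (inj₂ _)                y≢v here          = y≢v refl
    closed ¬z (inj₂ (_ , refl))       _   (step _ path) = ¬z path

-- Increasing trees that are δ-permutrees

-- kind true: parents; kind false: children
slots : Bool → Decoration → ℕ
slots true  = parentSlots
slots false = childSlots

slots-positive : ∀ b d → 1 ℕ.≤ slots b d
slots-positive true  none   = s≤s z≤n
slots-positive true  down   = s≤s z≤n
slots-positive true  up     = s≤s z≤n
slots-positive true  updown = s≤s z≤n
slots-positive false none   = s≤s z≤n
slots-positive false down   = s≤s z≤n
slots-positive false up     = s≤s z≤n
slots-positive false updown = s≤s z≤n

neighbour : ∀ {n} → Graph n → Bool → Fin n → Fin n → Bool
neighbour E true  v p = E v p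
neighbour E false v c = E c v

data Neighbour {m} (T : IncreasingTree m) (b : Bool) (v p : Fin (suc m)) : Set where
  upper : v ≢ fromℕ m → isParent T v ≡ not b → p ≡ above T v → Neighbour T b v p
  lower : p ≢ fromℕ m → isParent T p ≡ b     → above T p ≡ v → Neighbour T b v p

neighbour⇒Neighbour : ∀ {m} (T : IncreasingTree m) b {v p} →
                      neighbour (graph T) b v p ≡ true → Neighbour T b v p
neighbour⇒Neighbour T true  {v} {p} q with graph⇒childOf T v p q
... | parentAbove v≢root isV v↑p = upper v≢root isV (sym v↑p)
... | parentBelow p≢root isP p↑v = lower p≢root isP p↑v
neighbour⇒Neighbour T false {v} {p} q with graph⇒childOf T p v q
... | parentAbove p≢root isP p↑v = lower p≢root isP p↑v
... | parentBelow v≢root isV v↑p = upper v≢root isV (sym v↑p)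

-- Seen from v, a lower neighbour x has kind isParent T x and the neighbour above has kind
-- not (isParent T v).  Lower neighbours of one kind are unique; one sharing the kind of the
-- neighbour above needs two slots, and two slots of that kind put all smaller labels below v.
record Fits {m} (δ : Fin (suc m) → Decoration) (T : IncreasingTree m) : Set where
  field
    lower-unique          : ∀ {x y} → x ≢ fromℕ m → y ≢ fromℕ m →
                            isParent T x ≡ isParent T y → above T x ≡ above T y → x ≡ y
    shared-kind-two-slots : ∀ {x} → x ≢ fromℕ m → above T x ≢ fromℕ m →
                            isParent T x ≢ isParent T (above T x) →
                            slots (isParent T x) (δ (above T x)) ≡ 2
    two-slots⇒upPath      : ∀ {v} → v ≢ fromℕ m → slots (not (isParent T v)) (δ v) ≡ 2 →
                            ∀ {y} → y Fin.< v → UpPath T y v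

module _ {m} {δ : Fin (suc m) → Decoration} {T : IncreasingTree m} (fits : Fits δ T) where
  open Fits fits

  private
    E = graph T

  otherNeighbour : Bool → Fin (suc m) → Fin (suc m) → Bool
  otherNeighbour b v p = neighbour E b v p ∧ not (p ≡ᵇ above T v)

  otherNeighbour⇒lower : ∀ b v p → otherNeighbour b v p ≡ true →
                         p ≢ fromℕ m × isParent T p ≡ b × above T p ≡ v
  otherNeighbour⇒lower b v p q with ∧-true⁻ {neighbour E b v p} q
  ... | Np , p≢above with neighbour⇒Neighbour T b Np
  ...   | upper _ _ refl       =
    ⊥-elim (false≢true (trans (sym (cong not (≡⇒≡ᵇ {x = p} refl))) p≢above))
  ...   | lower p≢root isP p↑v = p≢root , isP , p↑v

  otherNeighbour-unique : ∀ b v → AtMostOne (otherNeighbour b v)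
  otherNeighbour-unique b v p q Op Oq with otherNeighbour⇒lower b v p Op | otherNeighbour⇒lower b v q Oq
  ... | p≢root , isP , p↑v | q≢root , isQ , q↑v =
    lower-unique p≢root q≢root (trans isP (sym isQ)) (trans p↑v (sym q↑v))

  shared-kind⇒two-slots : ∀ b {x} → x ≢ fromℕ m → isParent T x ≡ b →
                          above T x ≢ fromℕ m → isParent T (above T x) ≡ not b →
                          slots b (δ (above T x)) ≡ 2
  shared-kind⇒two-slots b x≢root isX x↑≢root isV = subst (λ k → slots k _ ≡ 2) isX
    (shared-kind-two-slots x≢root x↑≢root λ same → not-¬ refl (trans (sym isX) (trans same isV)))

  neighbour-unique : ∀ b v → slots b (δ v) ≢ 2 → AtMostOne (neighbour E b v)
  neighbour-unique b v ¬two p q Np Nq with neighbour⇒Neighbour T b Np | neighbour⇒Neighbour T b Nq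
  ... | upper _ _ p≡ | upper _ _ q≡ = trans p≡ (sym q≡)
  ... | lower p≢root isP p↑v | lower q≢root isQ q↑v =
    lower-unique p≢root q≢root (trans isP (sym isQ)) (trans p↑v (sym q↑v))
  ... | upper v≢root isV _ | lower q≢root isQ refl =
    ⊥-elim (¬two (shared-kind⇒two-slots b q≢root isQ v≢root isV))
  ... | lower p≢root isP refl | upper v≢root isV _ =
    ⊥-elim (¬two (shared-kind⇒two-slots b p≢root isP v≢root isV))

  neighbour-count : ∀ b v → countFin (neighbour E b v) ℕ.≤ slots b (δ v)
  neighbour-count b v with slots b (δ v) ℕ.≟ 2
  ... | no  ¬two =
    ℕ.≤-trans (countFin-atMostOne _ (neighbour-unique b v ¬two)) (slots-positive b (δ v))
  ... | yes two  = subst (countFin (neighbour E b v) ℕ.≤_) (sym two) (ℕ.≤-trans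
    (countFin-∪ (neighbour E b v) (_≡ᵇ above T v) (otherNeighbour b v) aboveOrOther)
    (ℕ.+-mono-≤ (ℕ.≤-reflexive (countFin-≡ᵇ (above T v)))
                (countFin-atMostOne _ (otherNeighbour-unique b v))))
    where
    aboveOrOther : ∀ p → neighbour E b v p ≡ true →
                   (p ≡ᵇ above T v) ≡ true ⊎ otherNeighbour b v p ≡ true
    aboveOrOther p Np with p ≡ᵇ above T v
    ... | true  = inj₁ refl
    ... | false = inj₂ (∧-true⁺ Np refl)

  upper-no-left : ∀ b {v j} → v ≢ fromℕ m → isParent T v ≡ not b → slots b (δ v) ≡ 2 →
                  InComp E v (above T v) j → ¬ (j Fin.< v)
  upper-no-left b {v} v≢root isV two r j<v = component-above T v≢root r (two-slots⇒upPath v≢root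
    (subst (λ k → slots k (δ v) ≡ 2) (sym (trans (cong not isV) (not-involutive b))) two) j<v)

  lower-no-right : ∀ {a v j} → a ≢ fromℕ m → above T a ≡ v → InComp E v a j → ¬ (v Fin.< j)
  lower-no-right a≢root a↑v r v<j = ℕ.<-asym v<j (component-below-< T a≢root a↑v r)

  neighbour-split : ∀ b v → slots b (δ v) ≡ 2 → LeftRightSplit E v (neighbour E b v)
  neighbour-split b v two = noStraddle , sideDetermines
    where
    noStraddle : ∀ a j k → neighbour E b v a ≡ true → InComp E v a j → InComp E v a k →
                 ¬ (j Fin.< v × v Fin.< k)
    noStraddle a j k Na rj rk (j<v , v<k) with neighbour⇒Neighbour T b Na
    ... | upper v≢root isV refl = upper-no-left b v≢root isV two rj j<v
    ... | lower a≢root _ a↑v    = lower-no-right a≢root a↑v rk v<k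
    sideDetermines : ∀ a a' j k → neighbour E b v a ≡ true → neighbour E b v a' ≡ true →
                     InComp E v a j → InComp E v a' k →
                     (j Fin.< v × k Fin.< v) ⊎ (v Fin.< j × v Fin.< k) → a ≡ a'
    sideDetermines a a' j k Na Na' rj rk sides with neighbour⇒Neighbour T b Na | neighbour⇒Neighbour T b Na'
    ... | upper _ _ refl | upper _ _ refl = refl
    ... | lower a≢root isA a↑v | lower a'≢root isA' a'↑v =
      lower-unique a≢root a'≢root (trans isA (sym isA')) (trans a↑v (sym a'↑v))
    ... | upper v≢root isV refl | lower a'≢root _ a'↑v =
      ⊥-elim ([ (λ (j<v , _) → upper-no-left b v≢root isV two rj j<v)
              , (λ (_ , v<k) → lower-no-right a'≢root a'↑v rk v<k) ]′ sides)
    ... | lower a≢root _ a↑v | upper v≢root isV refl =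
      ⊥-elim ([ (λ (_ , k<v) → upper-no-left b v≢root isV two rk k<v)
              , (λ (v<j , _) → lower-no-right a≢root a↑v rj v<j) ]′ sides)

  permutree : WellFormed T → Permutree (suc m) δ
  permutree wf = record
    { edge        = E
    ; irreflexive = graph-irreflexive T
    ; asymmetric  = graph-asymmetric T
    ; connected   = graph-connected T
    ; edges       = cong suc (edgeCount-graph T wf)
    ; parentsOK   = neighbour-count true
    ; childrenOK  = neighbour-count false
    ; upOK        = neighbour-split true
    ; downOK      = neighbour-split false
    }

  cubicSet-parent : ∀ wf {v} → v ≢ fromℕ m → isParent T v ≡ true →
                    ∣ cubicSet (permutree wf) v ∣ ≡ m ∸ toℕ v
  cubicSet-parent wf {v} v≢root isV = trans (countFin-cong allLater) (countFin-ltB v)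
    where
    allLater : ∀ j → (ltB v j ∧ inDescB E v j) ≡ ltB v j
    allLater j with ltB v j in v<j
    ... | false = refl
    ... | true  = anyFin⁺ (λ c → E c v ∧ reachW E v (suc m) c j) (above T v)
                    (∧-true⁺ (childOf⇒graph T _ _ (parentBelow v≢root isV refl))
                             (reach-upper T v≢root (ltB⇒< v<j)))

  cubicSet-child : ∀ wf {v} → isParent T v ≡ false → ∣ cubicSet (permutree wf) v ∣ ≡ 0
  cubicSet-child wf {v} isV = countFin-false _ noneLater
    where
    descendant-< : ∀ {j} → inDescB E v j ≡ true → toℕ j ℕ.< toℕ v
    descendant-< desc with anyFin⁻ _ desc
    ... | c , c→v∧r with ∧-true⁻ {E c v} c→v∧r
    ...   | c→v , r with neighbour⇒Neighbour T false c→v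
    ...     | upper _ isV' _     = ⊥-elim (false≢true (trans (sym isV) isV'))
    ...     | lower c≢root _ c↑v = component-below-< T c≢root c↑v r
    noneLater : ∀ j → (ltB v j ∧ inDescB E v j) ≡ false
    noneLater j with ltB v j in v<j
    ... | false = refl
    ... | true  = ¬-not λ desc → ℕ.<-asym (ltB⇒< v<j) (descendant-< desc)

-- Realising the corners

-- the least index satisfying p, or the last index if there is none
first : ∀ {n} → (Fin (suc n) → Bool) → Fin (suc n)
first {zero}  p = zero
first {suc n} p = if p zero then zero else suc (first (p ∘ suc))

first-holds : ∀ {n} (p : Fin (suc n) → Bool) → p (first p) ≡ true ⊎ first p ≡ fromℕ n
first-holds {zero}  p = inj₂ refl
first-holds {suc n} p with p zero in p0
... | true  = inj₁ p0
... | false = Sum.map₂ (cong suc) (first-holds (p ∘ suc))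

first-least : ∀ {n} (p : Fin (suc n) → Bool) {j} → p j ≡ true → toℕ (first p) ℕ.≤ toℕ j
first-least {zero}  p {zero}  _  = z≤n
first-least {suc n} p {j}     pj with p zero in p0
first-least {suc n} p {j}     pj | true  = z≤n
first-least {suc n} p {zero}  pj | false = ⊥-elim (false≢true (trans (sym p0) pj))
first-least {suc n} p {suc j} pj | false = s≤s (first-least (p ∘ suc) pj)

first-before : ∀ {n} (p : Fin (suc n) → Bool) {j} → toℕ j ℕ.< toℕ (first p) → p j ≡ false
first-before p j<first = ¬-not λ pj → ℕ.<⇒≱ j<first (first-least p pj)

-- whether a vertex with decoration d and orientation e has room for a new lower neighbour of kind b
accepts : Bool → Decoration → Bool → Bool
accepts b d e = isYes (b Bool.≟ e) ∨ isYes (slots b d ℕ.≟ 2)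

accepts-when : ∀ b d e → (b ≢ e → slots b d ≡ 2) → accepts b d e ≡ true
accepts-when true  d true  _   = refl
accepts-when false d false _   = refl
accepts-when true  d false two = isYes-true (slots true d ℕ.≟ 2) (two λ ())
accepts-when false d true  two = isYes-true (slots false d ℕ.≟ 2) (two λ ())

accepts⇒two : ∀ b d e → accepts b d e ≡ true → b ≢ e → slots b d ≡ 2
accepts⇒two b d e room b≢e = [ ⊥-elim ∘ b≢e ∘ witness (b Bool.≟ e) , witness (slots b d ℕ.≟ 2) ]′
                               (∨-true⁻ {isYes (b Bool.≟ e)} room)

no-room⇒child : ∀ d e → accepts true d e ≡ false → e ≡ false
no-room⇒child d false _ = refl

build : ∀ {m} → (Fin (suc m) → Decoration) → (Fin (suc m) → Bool) → IncreasingTree m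
build {zero}  δ e = root
build {suc m} δ e =
  node (e zero) (first λ j → accepts (e zero) (δ (suc j)) (e (suc j))) (build (δ ∘ suc) (e ∘ suc))

isParent-build : ∀ {m} δ e {x} → x ≢ fromℕ m → isParent (build δ e) x ≡ e x
isParent-build {zero}  δ e {zero}  x≢root = ⊥-elim (x≢root refl)
isParent-build {suc m} δ e {zero}  _      = refl
isParent-build {suc m} δ e {suc x} x≢root = isParent-build (δ ∘ suc) (e ∘ suc) (x≢root ∘ cong suc)

above-build-accepts : ∀ {m} δ e {x} → x ≢ fromℕ m → let t = above (build δ e) x in
                      t ≡ fromℕ m ⊎ accepts (e x) (δ t) (e t) ≡ true
above-build-accepts {zero}  δ e {zero}  x≢root = ⊥-elim (x≢root refl)
above-build-accepts {suc m} δ e {zero}  _      = Sum.swap (Sum.map₂ (cong suc) (first-holds _))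
above-build-accepts {suc m} δ e {suc x} x≢root =
  Sum.map₁ (cong suc) (above-build-accepts (δ ∘ suc) (e ∘ suc) (x≢root ∘ cong suc))

above-build-first : ∀ {m} δ e {x j} → x ≢ fromℕ m → toℕ x ℕ.< toℕ j →
                    accepts (e x) (δ j) (e j) ≡ true → toℕ (above (build δ e) x) ℕ.≤ toℕ j
above-build-first {zero}  δ e {zero}          x≢root _         _    = ⊥-elim (x≢root refl)
above-build-first {suc m} δ e {zero}  {suc j} _      _         room = s≤s (first-least _ room)
above-build-first {suc m} δ e {suc x} {suc j} x≢root (s≤s x<j) room =
  s≤s (above-build-first (δ ∘ suc) (e ∘ suc) (x≢root ∘ cong suc) x<j room)

childrenBelow-build : ∀ {m} δ e (t : Fin (suc m)) → (∀ j → toℕ j ℕ.< toℕ t → e j ≡ false) →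
                      ChildrenBelow t (build δ e)
childrenBelow-build         δ e zero    _     = _
childrenBelow-build {suc m} δ e (suc t) below =
    below zero (s≤s z≤n)
  , childrenBelow-build (δ ∘ suc) (e ∘ suc) t λ j j<t → below (suc j) (s≤s j<t)

build-wellFormed : ∀ {m} δ e → WellFormed (build {m} δ e)
build-wellFormed {zero}  δ e = _
build-wellFormed {suc m} δ e = childrenFirst , build-wellFormed (δ ∘ suc) (e ∘ suc)
  where
  target = first λ j → accepts (e zero) (δ (suc j)) (e (suc j))
  childrenFirst : e zero ≡ true → ChildrenBelow target (build (δ ∘ suc) (e ∘ suc))
  childrenFirst e0 = childrenBelow-build (δ ∘ suc) (e ∘ suc) target λ j j<target →
    no-room⇒child _ _
      (subst (λ b → accepts b (δ (suc j)) (e (suc j)) ≡ false) e0 (first-before _ j<target))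

module _ {m} (δ : Fin (suc m) → Decoration) (e : Fin (suc m) → Bool) where

  private
    B = build δ e

  isParent-build-≡ : ∀ {x y} → x ≢ fromℕ m → y ≢ fromℕ m →
                     isParent B x ≡ isParent B y → e x ≡ e y
  isParent-build-≡ x≢root y≢root same =
    trans (sym (isParent-build δ e x≢root)) (trans same (isParent-build δ e y≢root))

  earlier-same-kind : ∀ {x y} → y ≢ fromℕ m → e x ≡ e y → above B x ≡ above B y → ¬ (x Fin.< y)
  earlier-same-kind {x} {y} y≢root ex≡ey x↑≡y↑ x<y =
    ℕ.<-irrefl refl (ℕ.<-≤-trans (above-increasing B y≢root)
      (subst (λ z → toℕ z ℕ.≤ toℕ y) x↑≡y↑ (above-build-first δ e (<⇒≢fromℕ x<y) x<y
        (accepts-when (e x) (δ y) (e y) λ ex≢ey → ⊥-elim (ex≢ey ex≡ey)))))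

  build-lower-unique : ∀ {x y} → x ≢ fromℕ m → y ≢ fromℕ m →
                       isParent B x ≡ isParent B y → above B x ≡ above B y → x ≡ y
  build-lower-unique {x} {y} x≢root y≢root same x↑≡y↑ with Fin.<-cmp x y
  ... | tri< x<y _ _ =
    ⊥-elim (earlier-same-kind y≢root (isParent-build-≡ x≢root y≢root same) x↑≡y↑ x<y)
  ... | tri≈ _ x≡y _ = x≡y
  ... | tri> _ _ y<x =
    ⊥-elim (earlier-same-kind x≢root (isParent-build-≡ y≢root x≢root (sym same)) (sym x↑≡y↑) y<x)

  build-shared-kind-two-slots : ∀ {x} → x ≢ fromℕ m → above B x ≢ fromℕ m →
                                isParent B x ≢ isParent B (above B x) →
                                slots (isParent B x) (δ (above B x)) ≡ 2
  build-shared-kind-two-slots {x} x≢root x↑≢root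
    rewrite isParent-build δ e x≢root | isParent-build δ e x↑≢root = λ differ →
    [ ⊥-elim ∘ x↑≢root , (λ room → accepts⇒two _ _ _ room differ) ]′ (above-build-accepts δ e x≢root)

  build-two-slots⇒upPath : ∀ {v} → v ≢ fromℕ m → slots (not (isParent B v)) (δ v) ≡ 2 →
                           ∀ {y} → y Fin.< v → UpPath B y v
  build-two-slots⇒upPath {v} v≢root two {y} = climb y (>-wellFounded y)
    where
    room : ∀ b → accepts b (δ v) (e v) ≡ true
    room b = accepts-when b (δ v) (e v) λ b≢ev → subst (λ k → slots k (δ v) ≡ 2)
      (trans (cong not (isParent-build δ e v≢root)) (sym (¬-not b≢ev))) two
    climb : ∀ y → Acc Fin._>_ y → y Fin.< v → UpPath B y v
    climb y (acc rs) y<v =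
      step y≢root (next (ℕ.m≤n⇒m<n∨m≡n (above-build-first δ e y≢root y<v (room (e y)))))
      where
      y≢root = <⇒≢fromℕ y<v
      next : toℕ (above B y) ℕ.< toℕ v ⊎ toℕ (above B y) ≡ toℕ v → UpPath B (above B y) v
      next (inj₁ y↑<v) = climb (above B y) (rs (above-increasing B y≢root)) y↑<v
      next (inj₂ y↑≡v) = subst (UpPath B (above B y)) (Fin.toℕ-injective y↑≡v) here

  build-fits : Fits δ B
  build-fits = record
    { lower-unique          = build-lower-unique
    ; shared-kind-two-slots = build-shared-kind-two-slots
    ; two-slots⇒upPath      = build-two-slots⇒upPath
    }

-- The cubic vectors span a box

orientation : ∀ {m} → (Fin m → Bool) → Fin (suc m) → Bool
orientation {zero}  σ _       = false
orientation {suc m} σ zero    = σ zero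
orientation {suc m} σ (suc x) = orientation (σ ∘ suc) x

orientation-inject₁ : ∀ {m} (σ : Fin m → Bool) i → orientation σ (inject₁ i) ≡ σ i
orientation-inject₁ σ zero    = refl
orientation-inject₁ σ (suc i) = orientation-inject₁ (σ ∘ suc) i

cubicVector-bound : ∀ {m δ} (P : Permutree (suc m) δ) i → cubicVector P i ℕ.≤ m ∸ toℕ i
cubicVector-bound {m} P i =
  ℕ.≤-trans (countFin-mono later)
            (ℕ.≤-reflexive (trans (countFin-ltB (inject₁ i)) (cong (m ∸_) (Fin.toℕ-inject₁ i))))
  where
  later : ∀ j → (ltB (inject₁ i) j ∧ inDescB (edge P) (inject₁ i) j) ≡ true →
          ltB (inject₁ i) j ≡ true
  later j = proj₁ ∘ ∧-true⁻

corner-realised : ∀ {m} (δ : Fin (suc m) → Decoration) σ →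
                  cubicVectors δ (corner (λ i → m ∸ toℕ i) σ)
corner-realised {m} δ σ = permutree fits wf , cubic
  where
  e    = orientation σ
  fits = build-fits δ e
  wf   = build-wellFormed δ e
  inject₁≢root : ∀ i → inject₁ i ≢ fromℕ m
  inject₁≢root i = Fin.fromℕ≢inject₁ ∘ sym
  isParent-inject₁ : ∀ i → isParent (build δ e) (inject₁ i) ≡ σ i
  isParent-inject₁ i = trans (isParent-build δ e (inject₁≢root i)) (orientation-inject₁ σ i)
  cubic : ∀ i → cubicVector (permutree fits wf) i ≡ corner (λ i → m ∸ toℕ i) σ i
  cubic i with σ i in σi
  ... | true  = trans (cubicSet-parent fits wf (inject₁≢root i) (trans (isParent-inject₁ i) σi))
                      (cong (m ∸_) (Fin.toℕ-inject₁ i))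
  ... | false = cubicSet-child fits wf (trans (isParent-inject₁ i) σi)

cubicVectors-hullIsBox : ∀ {m} (δ : Fin (suc m) → Decoration) →
                         HullIsBox (cubicVectors δ) (λ i → m ∸ toℕ i)
cubicVectors-hullIsBox δ = record
  { positive = λ i → ℕ.m<n⇒0<n∸m (Fin.toℕ<n i)
  ; bounded  = λ (P , c≡x) i → subst (ℕ._≤ _) (c≡x i) (cubicVector-bound P i)
  ; corners  = corner-realised δ
  }

-- The boundary conventions δ₁ = δₙ = none are not needed.
theorem3p7 : (m : ℕ) (δ : Fin (suc m) → Decoration) →
             δ zero ≡ none → δ (fromℕ m) ≡ none →
             NormallyEquivalent (cubicVectors δ) (cubeVertices {m})
theorem3p7 m δ _ _ = hullIsBox⇒normallyEquivalent (cubicVectors-hullIsBox δ) cube-hullIsBox
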